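{- Let $i\in\mathbb{Z}$, let $a,a'\in\mathbb{A}_i$ be distinct atoms and $x\in\mathsf{Set}_i$. Let $Z\in\mathsf{Pred}$ with $a'\#Z$ and let $k\in\mathbb{Z}$, $z\in\mathsf{Set}_k$ with $a'\#z$. Then: (1) $Z[a\mapsto x]=((a'\ a)\cdot Z)[a'\mapsto x]$ and $z[a\mapsto x]=((a'\ a)\cdot z)[a'\mapsto x]$; (2) $\mathrm{supp}(Z[a\mapsto x])\subseteq(\mathrm{supp}(Z)\setminus\{a\})\cup\mathrm{supp}(x)$ and $\mathrm{supp}(z[a\mapsto x])\subseteq(\mathrm{supp}(z)\setminus\{a\})\cup\mathrm{supp}(x)$; (3) if $a\#x$ then $a\#Z[a\mapsto x]$ and $a\#z[a\mapsto x]$.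
   Context: Atoms: for each $i\in\mathbb{Z}$ fix a countably infinite set $\mathbb{A}_i$ of atoms, pairwise disjoint, $\mathbb{A}=\bigcup_i\mathbb{A}_i$, $\mathrm{level}(a)=i$ iff $a\in\mathbb{A}_i$. Permutations are finitely-supported level-preserving bijections of $\mathbb{A}$; $(a\ b)$ is the swapping of $a,b$ (acting on all objects below by renaming atoms); $\mathrm{supp}(x)$ is the least finite set of atoms such that every permutation fixing it pointwise fixes $x$, and $a\#x$ means $a\notin\mathrm{supp}(x)$. $[a]X$ is nominal atoms-abstraction (binding $a$ in $X$): $[a]X=[b]((b\ a)\cdot X)$ when $b\#X$, and $\mathrm{supp}([a]X)=\mathrm{supp}(X)\setminus\{a\}$. Internal syntax: $\mathsf{Pred}$ and $\mathsf{Set}_i$ ($i\in\mathbb{Z}$) are defined inductively: $\mathsf{atm}(a)\in\mathsf{Set}_i$ for $a\in\mathbb{A}_i$; $\mathsf{and}(\mathcal X)\in\mathsf{Pred}$ for finite $\mathcal X\subseteq\mathsf{Pred}$; $\mathsf{neg}(X)$; $\mathsf{all}([a]X)$ for $a\in\mathbb{A}$; $\mathsf{elt}(x,a)\in\mathsf{Pred}$ for $a\in\mathbb{A}_{i+1}$, $x\in\mathsf{Set}_i$; $\mathsf{st}([a]X)\in\mathsf{Set}_i$ for $a\in\mathbb{A}_{i-1}$, $X\in\mathsf{Pred}$. Sigma-action: for $a\in\mathbb{A}_i$, $x\in\mathsf{Set}_i$, the well-defined operation $Z[a\mapsto x]$, $z[a\mapsto x]$ is given by (with $b,c$ atoms distinct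 from $a$): $\mathsf{and}(\mathcal X)[a\mapsto x]=\mathsf{and}(\{X[a\mapsto x]\mid X\in\mathcal X\})$; $\mathsf{neg}(X)[a\mapsto x]=\mathsf{neg}(X[a\mapsto x])$; $\mathsf{all}([b]X)[a\mapsto x]=\mathsf{all}([b](X[a\mapsto x]))$ if $b\#x$; $\mathsf{elt}(y,a)[a\mapsto\mathsf{atm}(n)]=\mathsf{elt}(y[a\mapsto\mathsf{atm}(n)],n)$ for any $n\in\mathbb{A}_i$; $\mathsf{elt}(y,a)[a\mapsto\mathsf{st}([a']X')]=X'[a'\mapsto y[a\mapsto\mathsf{st}([a']X')]]$ for fresh $a'\in\mathbb{A}_{i-1}$; $\mathsf{elt}(y,b)[a\mapsto x]=\mathsf{elt}(y[a\mapsto x],b)$; $\mathsf{atm}(a)[a\mapsto x]=x$; $\mathsf{atm}(b)[a\mapsto x]=\mathsf{atm}(b)$; $\mathsf{st}([c]X)[a\mapsto x]=\mathsf{st}([c](X[a\mapsto x]))$ if $c\#x$. -}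

module Defs where

open import Data.Bool using (Bool; true; false; if_then_else_)
open import Data.Nat using (ℕ)
import Data.Nat as ℕ
open import Data.Integer using (ℤ; pred)
import Data.Integer as ℤ
open import Data.List using (List; []; _∷_; _++_; filter)
open import Data.List.Relation.Unary.All using (All)
open import Data.List.Relation.Unary.Any using (Any)
open import Data.List.Relation.Binary.Pointwise using (Pointwise)
open import Data.List.Membership.Propositional using (_∉_)
open import Data.Product using (_×_; _,_)
open import Relation.Nullary using (Dec; yes; no; ¬_; ¬?)
open import Relation.Nullary.Decidable using (⌊_⌋)
open import Relation.Binary.PropositionalEquality using (_≡_; _≢_; refl; cong₂)

-- Atoms: the atom  mkA i n  is the n-th atom of level i, i.e. 𝔸_i ≅ ℕ.

record Atom : Set where
  constructor mkA
  field
    lvl : ℤ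
    nm  : ℕ
open Atom public

_≟A_ : (a b : Atom) → Dec (a ≡ b)
mkA i n ≟A mkA j m with i ℤ.≟ j | n ℕ.≟ m
... | yes refl | yes refl = yes refl
... | no i≢j   | _        = no λ { refl → i≢j refl }
... | yes _    | no n≢m   = no λ { refl → n≢m refl }

remove : Atom → List Atom → List Atom
remove a = filter (λ c → ¬? (c ≟A a))

-- Raw internal syntax (to be read up to α-equivalence _≈P_/_≈S_ below).
--   Tm i  = raw terms of Set_i.
--   atm {i} n      = atm(a)        with a = mkA i n ∈ 𝔸_i
--   st  {i} n X    = st([a]X)      with a = mkA (pred i) n ∈ 𝔸_{i-1}, result in Set_i
--   elt i y n      = elt(y,a)      with a = mkA i n ∈ 𝔸_i and y ∈ Set_{i-1}
--   all a X        = all([a]X)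
--   and Xs         = and(𝒳), the finite set 𝒳 given by a list (see _≈P_)

mutual
  data Pred : Set where
    and : List Pred → Pred
    neg : Pred → Pred
    all : Atom → Pred → Pred
    elt : (i : ℤ) → Tm (pred i) → ℕ → Pred

  data Tm : ℤ → Set where
    atm : ∀ {i} → ℕ → Tm i
    st  : ∀ {i} → ℕ → Pred → Tm i

-- Free atoms (= nominal support of the α-class)

mutual
  fvP : Pred → List Atom
  fvP (and Xs)    = fvPs Xs
  fvP (neg X)     = fvP X
  fvP (all a X)   = remove a (fvP X)
  fvP (elt i y n) = mkA i n ∷ fvS y

  fvPs : List Pred → List Atom
  fvPs []       = []
  fvPs (X ∷ Xs) = fvP X ++ fvPs Xs

  fvS : ∀ {i} → Tm i → List Atom
  fvS {i} (atm n)  = mkA i n ∷ []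
  fvS {i} (st n X) = remove (mkA (pred i) n) (fvP X)

-- Swapping (a b) with a = mkA i n₁, b = mkA i n₂ (same level i).

swapName : ℕ → ℕ → ℕ → ℕ
swapName n₁ n₂ k =
  if ⌊ k ℕ.≟ n₁ ⌋ then n₂ else (if ⌊ k ℕ.≟ n₂ ⌋ then n₁ else k)

swName : ℤ → ℕ → ℕ → ℤ → ℕ → ℕ
swName i n₁ n₂ j k = if ⌊ j ℤ.≟ i ⌋ then swapName n₁ n₂ k else k

swAtom : ℤ → ℕ → ℕ → Atom → Atom
swAtom i n₁ n₂ (mkA j k) = mkA j (swName i n₁ n₂ j k)

mutual
  swapP : ℤ → ℕ → ℕ → Pred → Pred
  swapP i n₁ n₂ (and Xs)    = and (swapPs i n₁ n₂ Xs)
  swapP i n₁ n₂ (neg X)     = neg (swapP i n₁ n₂ X)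
  swapP i n₁ n₂ (all a X)   = all (swAtom i n₁ n₂ a) (swapP i n₁ n₂ X)
  swapP i n₁ n₂ (elt j y k) = elt j (swapS i n₁ n₂ y) (swName i n₁ n₂ j k)

  swapPs : ℤ → ℕ → ℕ → List Pred → List Pred
  swapPs i n₁ n₂ []       = []
  swapPs i n₁ n₂ (X ∷ Xs) = swapP i n₁ n₂ X ∷ swapPs i n₁ n₂ Xs

  swapS : ∀ {j} → ℤ → ℕ → ℕ → Tm j → Tm j
  swapS {j} i n₁ n₂ (atm k)  = atm (swName i n₁ n₂ j k)
  swapS {j} i n₁ n₂ (st k X) = st (swName i n₁ n₂ (pred j) k) (swapP i n₁ n₂ X)

-- α-equivalence (equality of the nominal syntax): binders compared via a
-- fresh atom, and(𝒳) compared as finite sets.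

mutual
  data _≈P_ : Pred → Pred → Set where
    and-≈ : ∀ {Xs Ys} →
            All (λ X → Any (λ Y → X ≈P Y) Ys) Xs →
            All (λ Y → Any (λ X → X ≈P Y) Xs) Ys →
            and Xs ≈P and Ys
    neg-≈ : ∀ {X Y} → X ≈P Y → neg X ≈P neg Y
    all-≈ : ∀ {j n m X Y} (c : ℕ) → mkA j c ∉ fvP X → mkA j c ∉ fvP Y →
            swapP j c n X ≈P swapP j c m Y →
            all (mkA j n) X ≈P all (mkA j m) Y
    elt-≈ : ∀ {i y y' n} → y ≈S y' → elt i y n ≈P elt i y' n

  data _≈S_ : ∀ {i} → Tm i → Tm i → Set where
    atm-≈ : ∀ {i n} → atm {i} n ≈S atm {i} n
    st-≈  : ∀ {i n m X Y} (c : ℕ) →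
            mkA (pred i) c ∉ fvP X → mkA (pred i) c ∉ fvP Y →
            swapP (pred i) c n X ≈P swapP (pred i) c m Y →
            st {i} n X ≈S st {i} m Y

-- The sigma-action, as the graph of the operation given by the defining
-- equations, closed under α-equivalence.
--   SubP i n x Z W   means   Z[a ↦ x] = W   for a = mkA i n, x ∈ Set_i
--   SubS i n x k z w means   z[a ↦ x] = w   for z, w ∈ Set_k

mutual
  data SubP (i : ℤ) (n : ℕ) : Tm i → Pred → Pred → Set where
    s-and : ∀ {x Xs Ws} → Pointwise (SubP i n x) Xs Ws →
            SubP i n x (and Xs) (and Ws)
    s-neg : ∀ {x X W} → SubP i n x X W → SubP i n x (neg X) (neg W)
    s-all : ∀ {x b X W} → b ≢ mkA i n → b ∉ fvS x → SubP i n x X W →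
            SubP i n x (all b X) (all b W)
    s-elt-atm : ∀ {y y' m} → SubS i n (atm m) (pred i) y y' →
            SubP i n (atm m) (elt i y n) (elt i y' m)
    s-elt-st : ∀ {y y' m X' W} →
            mkA (pred i) m ∉ fvS y →
            SubS i n (st m X') (pred i) y y' →
            SubP (pred i) m y' X' W →
            SubP i n (st m X') (elt i y n) W
    s-elt-other : ∀ {x j y y' m} → mkA j m ≢ mkA i n →
            SubS i n x (pred j) y y' →
            SubP i n x (elt j y m) (elt j y' m)
    s-α : ∀ {x x₀ Z Z₀ W₀ W} → x ≈S x₀ → Z ≈P Z₀ → SubP i n x₀ Z₀ W₀ → W₀ ≈P W →
            SubP i n x Z W

  data SubS (i : ℤ) (n : ℕ) : Tm i → (k : ℤ) → Tm k → Tm k → Set where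
    s-atm-self  : ∀ {x} → SubS i n x i (atm n) x
    s-atm-other : ∀ {x k m} → mkA k m ≢ mkA i n → SubS i n x k (atm m) (atm m)
    s-st : ∀ {x k c X W} → mkA (pred k) c ≢ mkA i n → mkA (pred k) c ∉ fvS x →
            SubP i n x X W → SubS i n x k (st c X) (st c W)
    s-α : ∀ {x x₀ k z z₀ w₀ w} → x ≈S x₀ → z ≈S z₀ → SubS i n x₀ k z₀ w₀ → w₀ ≈S w →
            SubS i n x k z w

module Submission where

-- Part (1) is an instance of equivariance.  We develop level-preserving
-- renamings of names (swappings being the renamings swName), show that free
-- atoms and α-equivalence are well behaved under injective renamings, and
-- prove the key lemma sub-renP/sub-renS: if Z[a ↦ x] = W then
-- (f·Z)[f(a) ↦ g·x] = g·W for injective f, g that agree on the free atoms of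
-- Z other than a.  With f = (a' a) and g = id this gives one direction of
-- (1); the converse is the same fact for (a' a)·Z, in which a is fresh.
-- Part (2) is a direct induction (sub-fvP/sub-fvS) using that free atoms are
-- invariant under α-equivalence, and (3) is a corollary of (2).

open import Defs
open import Data.Nat using (ℕ; suc)
open import Data.Nat.Properties using (<-irrefl)
open import Data.Integer using (ℤ; pred)
import Data.Integer as ℤ
import Data.Nat as ℕ
open import Data.List using (List; []; _∷_; _++_; map)
open import Data.List.Extrema.Nat using (max; xs≤max)
open import Data.List.Relation.Unary.All as All using (All; []; _∷_)
open import Data.List.Relation.Unary.Any using (Any; here; there)
open import Data.List.Relation.Binary.Pointwise using (Pointwise; []; _∷_)
open import Data.List.Membership.Propositional using (_∈_; _∉_)
open import Data.List.Membership.Propositional.Properties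
  using (∈-filter⁺; ∈-filter⁻; ∈-++⁺ˡ; ∈-++⁺ʳ; ∈-++⁻; ∈-map⁺)
open import Data.Product using (_×_; _,_; ∃)
import Data.Product as Product
open import Data.Sum using (_⊎_; inj₁; inj₂; [_,_]′)
import Data.Sum as Sum
open import Relation.Nullary using (Dec; yes; no; ¬?; contradiction)
open import Relation.Binary.PropositionalEquality
open import Function.Bundles using (_⇔_; mk⇔)

Ren : Set
Ren = ℤ → ℕ → ℕ

Inj : Ren → Set
Inj ρ = ∀ j {k k'} → ρ j k ≡ ρ j k' → k ≡ k'

renA : Ren → Atom → Atom
renA ρ c = mkA (lvl c) (ρ (lvl c) (nm c))

idᵣ : Ren
idᵣ j k = k

_∘ᵣ_ : Ren → Ren → Ren
(ρ ∘ᵣ σ) j k = ρ j (σ j k)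

_≗ᵣ_ : Ren → Ren → Set
ρ ≗ᵣ σ = ∀ j k → ρ j k ≡ σ j k

id-inj : Inj idᵣ
id-inj j eq = eq

∘-inj : ∀ {ρ σ} → Inj ρ → Inj σ → Inj (ρ ∘ᵣ σ)
∘-inj iρ iσ j eq = iσ j (iρ j eq)

renA-inj : ∀ {ρ} → Inj ρ → ∀ {c d} → renA ρ c ≡ renA ρ d → c ≡ d
renA-inj iρ {mkA j k} {mkA j' k'} eq with cong lvl eq
... | refl = cong (mkA j) (iρ j (cong nm eq))

renA-≢ : ∀ {ρ} → Inj ρ → ∀ {c d} → c ≢ d → renA ρ c ≢ renA ρ d
renA-≢ iρ c≢d eq = c≢d (renA-inj iρ eq)

-- Renaming the raw syntax, binders included (no capture avoidance: the
-- renamings used are injective, so no two atoms are ever identified).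
mutual
  renP : Ren → Pred → Pred
  renP ρ (and Xs)    = and (renPs ρ Xs)
  renP ρ (neg X)     = neg (renP ρ X)
  renP ρ (all a X)   = all (renA ρ a) (renP ρ X)
  renP ρ (elt j y k) = elt j (renS ρ y) (ρ j k)

  renPs : Ren → List Pred → List Pred
  renPs ρ []       = []
  renPs ρ (X ∷ Xs) = renP ρ X ∷ renPs ρ Xs

  renS : ∀ {j} → Ren → Tm j → Tm j
  renS {j} ρ (atm k)  = atm (ρ j k)
  renS {j} ρ (st k X) = st (ρ (pred j) k) (renP ρ X)

mutual
  ren-congP : ∀ {ρ σ} → ρ ≗ᵣ σ → ∀ X → renP ρ X ≡ renP σ X
  ren-congP e (and Xs)          = cong and (ren-congPs e Xs)
  ren-congP e (neg X)           = cong neg (ren-congP e X)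
  ren-congP e (all (mkA j k) X) = cong₂ all (cong (mkA j) (e j k)) (ren-congP e X)
  ren-congP e (elt j y k)       = cong₂ (elt j) (ren-congS e y) (e j k)

  ren-congPs : ∀ {ρ σ} → ρ ≗ᵣ σ → ∀ Xs → renPs ρ Xs ≡ renPs σ Xs
  ren-congPs e []       = refl
  ren-congPs e (X ∷ Xs) = cong₂ _∷_ (ren-congP e X) (ren-congPs e Xs)

  ren-congS : ∀ {ρ σ j} → ρ ≗ᵣ σ → (y : Tm j) → renS ρ y ≡ renS σ y
  ren-congS {j = j} e (atm k)  = cong atm (e j k)
  ren-congS {j = j} e (st k X) = cong₂ st (e (pred j) k) (ren-congP e X)

mutual
  ren-∘P : ∀ ρ σ X → renP ρ (renP σ X) ≡ renP (ρ ∘ᵣ σ) X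
  ren-∘P ρ σ (and Xs)    = cong and (ren-∘Ps ρ σ Xs)
  ren-∘P ρ σ (neg X)     = cong neg (ren-∘P ρ σ X)
  ren-∘P ρ σ (all a X)   = cong (all _) (ren-∘P ρ σ X)
  ren-∘P ρ σ (elt j y k) = cong (λ y → elt j y _) (ren-∘S ρ σ y)

  ren-∘Ps : ∀ ρ σ Xs → renPs ρ (renPs σ Xs) ≡ renPs (ρ ∘ᵣ σ) Xs
  ren-∘Ps ρ σ []       = refl
  ren-∘Ps ρ σ (X ∷ Xs) = cong₂ _∷_ (ren-∘P ρ σ X) (ren-∘Ps ρ σ Xs)

  ren-∘S : ∀ {j} ρ σ (y : Tm j) → renS ρ (renS σ y) ≡ renS (ρ ∘ᵣ σ) y
  ren-∘S ρ σ (atm k)  = refl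
  ren-∘S ρ σ (st k X) = cong (st _) (ren-∘P ρ σ X)

mutual
  ren-idP : ∀ X → renP idᵣ X ≡ X
  ren-idP (and Xs)    = cong and (ren-idPs Xs)
  ren-idP (neg X)     = cong neg (ren-idP X)
  ren-idP (all a X)   = cong (all a) (ren-idP X)
  ren-idP (elt j y k) = cong (λ y → elt j y k) (ren-idS y)

  ren-idPs : ∀ Xs → renPs idᵣ Xs ≡ Xs
  ren-idPs []       = refl
  ren-idPs (X ∷ Xs) = cong₂ _∷_ (ren-idP X) (ren-idPs Xs)

  ren-idS : ∀ {j} (y : Tm j) → renS idᵣ y ≡ y
  ren-idS (atm k)  = refl
  ren-idS (st k X) = cong (st k) (ren-idP X)

swA : ℤ → ℕ → ℕ → Atom → Atom
swA i p q = renA (swName i p q)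

mutual
  swap-renP : ∀ i p q X → swapP i p q X ≡ renP (swName i p q) X
  swap-renP i p q (and Xs)    = cong and (swap-renPs i p q Xs)
  swap-renP i p q (neg X)     = cong neg (swap-renP i p q X)
  swap-renP i p q (all a X)   = cong (all _) (swap-renP i p q X)
  swap-renP i p q (elt j y k) = cong (λ y → elt j y _) (swap-renS i p q y)

  swap-renPs : ∀ i p q Xs → swapPs i p q Xs ≡ renPs (swName i p q) Xs
  swap-renPs i p q []       = refl
  swap-renPs i p q (X ∷ Xs) = cong₂ _∷_ (swap-renP i p q X) (swap-renPs i p q Xs)

  swap-renS : ∀ {j} i p q (y : Tm j) → swapS i p q y ≡ renS (swName i p q) y
  swap-renS i p q (atm k)  = refl
  swap-renS i p q (st k X) = cong (st _) (swap-renP i p q X)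

swA-left : ∀ i p q → swA i p q (mkA i p) ≡ mkA i q
swA-left i p q with i ℤ.≟ i | p ℕ.≟ p
... | yes _   | yes _   = refl
... | no i≢i  | _       = contradiction refl i≢i
... | yes _   | no p≢p  = contradiction refl p≢p

swA-right : ∀ i p q → swA i p q (mkA i q) ≡ mkA i p
swA-right i p q with i ℤ.≟ i | q ℕ.≟ p | q ℕ.≟ q
... | no i≢i | _        | _       = contradiction refl i≢i
... | yes _  | yes refl | _       = refl
... | yes _  | no _     | yes _   = refl
... | yes _  | no _     | no q≢q  = contradiction refl q≢q

swA-other : ∀ i p q c → c ≢ mkA i p → c ≢ mkA i q → swA i p q c ≡ c
swA-other i p q (mkA j k) c≢p c≢q with j ℤ.≟ i
... | no _ = refl
... | yes refl with k ℕ.≟ p | k ℕ.≟ q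
...   | yes refl | _        = contradiction refl c≢p
...   | no _     | yes refl = contradiction refl c≢q
...   | no _     | no _     = refl

swA-inv : ∀ i p q c → swA i p q (swA i q p c) ≡ c
swA-inv i p q c with c ≟A mkA i q | c ≟A mkA i p
... | yes refl | _        = trans (cong (swA i p q) (swA-left i q p)) (swA-left i p q)
... | no _     | yes refl = trans (cong (swA i p q) (swA-right i q p)) (swA-right i p q)
... | no c≢q   | no c≢p   =
  trans (cong (swA i p q) (swA-other i q p c c≢q c≢p)) (swA-other i p q c c≢p c≢q)

swap-inj : ∀ i p q → Inj (swName i p q)
swap-inj i p q j {k} {k'} eq = cong nm (begin
  mkA j k                          ≡⟨ sym (swA-inv i q p (mkA j k)) ⟩
  swA i q p (swA i p q (mkA j k))  ≡⟨ cong (λ m → swA i q p (mkA j m)) eq ⟩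
  swA i q p (swA i p q (mkA j k')) ≡⟨ swA-inv i q p (mkA j k') ⟩
  mkA j k'                         ∎)
  where open ≡-Reasoning

∈-remove⁻ : ∀ {c a L} → c ∈ remove a L → c ∈ L × c ≢ a
∈-remove⁻ {a = a} {L} = ∈-filter⁻ (λ d → ¬? (d ≟A a)) {xs = L}

∈-remove⁺ : ∀ {c a L} → c ∈ L → c ≢ a → c ∈ remove a L
∈-remove⁺ {a = a} = ∈-filter⁺ (λ d → ¬? (d ≟A a))

mutual
  fv-ren⁺P : ∀ {ρ} → Inj ρ → ∀ X {c} → c ∈ fvP X → renA ρ c ∈ fvP (renP ρ X)
  fv-ren⁺P iρ (and Xs)    p = fv-ren⁺Ps iρ Xs p
  fv-ren⁺P iρ (neg X)     p = fv-ren⁺P iρ X p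
  fv-ren⁺P iρ (all a X)   p with ∈-remove⁻ p
  ... | q , c≢a = ∈-remove⁺ (fv-ren⁺P iρ X q) (renA-≢ iρ c≢a)
  fv-ren⁺P iρ (elt j y k) (here refl) = here refl
  fv-ren⁺P iρ (elt j y k) (there p)   = there (fv-ren⁺S iρ y p)

  fv-ren⁺Ps : ∀ {ρ} → Inj ρ → ∀ Xs {c} → c ∈ fvPs Xs → renA ρ c ∈ fvPs (renPs ρ Xs)
  fv-ren⁺Ps iρ (X ∷ Xs) p with ∈-++⁻ (fvP X) p
  ... | inj₁ q = ∈-++⁺ˡ (fv-ren⁺P iρ X q)
  ... | inj₂ q = ∈-++⁺ʳ (fvP (renP _ X)) (fv-ren⁺Ps iρ Xs q)

  fv-ren⁺S : ∀ {ρ j} → Inj ρ → (y : Tm j) → ∀ {c} → c ∈ fvS y → renA ρ c ∈ fvS (renS ρ y)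
  fv-ren⁺S iρ (atm k)  (here refl) = here refl
  fv-ren⁺S iρ (st k X) p with ∈-remove⁻ p
  ... | q , c≢b = ∈-remove⁺ (fv-ren⁺P iρ X q) (renA-≢ iρ c≢b)

mutual
  fv-ren⁻P : ∀ ρ X {d} → d ∈ fvP (renP ρ X) → ∃ λ c → c ∈ fvP X × d ≡ renA ρ c
  fv-ren⁻P ρ (and Xs)    p = fv-ren⁻Ps ρ Xs p
  fv-ren⁻P ρ (neg X)     p = fv-ren⁻P ρ X p
  fv-ren⁻P ρ (all a X)   p with ∈-remove⁻ p
  ... | q , d≢ρa with fv-ren⁻P ρ X q
  ...   | c , c∈X , refl = c , ∈-remove⁺ c∈X (λ { refl → d≢ρa refl }) , refl
  fv-ren⁻P ρ (elt j y k) (here refl) = mkA j k , here refl , refl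
  fv-ren⁻P ρ (elt j y k) (there p)   = Product.map₂ (Product.map₁ there) (fv-ren⁻S ρ y p)

  fv-ren⁻Ps : ∀ ρ Xs {d} → d ∈ fvPs (renPs ρ Xs) → ∃ λ c → c ∈ fvPs Xs × d ≡ renA ρ c
  fv-ren⁻Ps ρ (X ∷ Xs) p with ∈-++⁻ (fvP (renP ρ X)) p
  ... | inj₁ q = Product.map₂ (Product.map₁ ∈-++⁺ˡ) (fv-ren⁻P ρ X q)
  ... | inj₂ q = Product.map₂ (Product.map₁ (∈-++⁺ʳ (fvP X))) (fv-ren⁻Ps ρ Xs q)

  fv-ren⁻S : ∀ ρ {j} (y : Tm j) {d} → d ∈ fvS (renS ρ y) → ∃ λ c → c ∈ fvS y × d ≡ renA ρ c
  fv-ren⁻S ρ {j} (atm k)  (here refl) = mkA j k , here refl , refl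
  fv-ren⁻S ρ     (st k X) p with ∈-remove⁻ p
  ... | q , d≢ρb with fv-ren⁻P ρ X q
  ...   | c , c∈X , refl = c , ∈-remove⁺ c∈X (λ { refl → d≢ρb refl }) , refl

fresh-ren : ∀ {ρ} → Inj ρ → ∀ {c} X → c ∉ fvP X → renA ρ c ∉ fvP (renP ρ X)
fresh-ren {ρ} iρ X c∉X p with fv-ren⁻P ρ X p
... | c' , c'∈X , eq with renA-inj iρ eq
...   | refl = c∉X c'∈X

fresh : (l : ℤ) (L : List Atom) → ∃ λ e → mkA l e ∉ L
fresh l L = suc (max 0 (map nm L)) ,
  λ p → <-irrefl refl (All.lookup (xs≤max 0 (map nm L)) (∈-map⁺ nm p))

fv-swap⁺P : ∀ j p q X {c} → c ∈ fvP X → swA j p q c ∈ fvP (swapP j p q X)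
fv-swap⁺P j p q X c∈X =
  subst (λ T → _ ∈ fvP T) (sym (swap-renP j p q X)) (fv-ren⁺P (swap-inj j p q) X c∈X)

fv-swap⁻P : ∀ j p q X {d} → d ∈ fvP (swapP j p q X) → swA j q p d ∈ fvP X
fv-swap⁻P j p q X d∈ with fv-ren⁻P (swName j p q) X (subst (λ T → _ ∈ fvP T) (swap-renP j p q X) d∈)
... | c , c∈X , refl = subst (_∈ fvP X) (sym (swA-inv j q p c)) c∈X

fv-swap⁻S : ∀ {k} j p q (z : Tm k) {d} → d ∈ fvS (swapS j p q z) → swA j q p d ∈ fvS z
fv-swap⁻S j p q z d∈ with fv-ren⁻S (swName j p q) z (subst (λ T → _ ∈ fvS T) (swap-renS j p q z) d∈)
... | c , c∈z , refl = subst (_∈ fvS z) (sym (swA-inv j q p c)) c∈z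

-- It is how a binder is renamed apart.
rebind : Ren → ℤ → ℕ → ℕ → Ren
rebind ρ l bk e = swName l e (ρ l bk) ∘ᵣ ρ

rebind-inj : ∀ {ρ} → Inj ρ → ∀ l bk e → Inj (rebind ρ l bk e)
rebind-inj {ρ} iρ l bk e = ∘-inj (swap-inj l e (ρ l bk)) iρ

rebind-binder : ∀ ρ l bk e → renA (rebind ρ l bk e) (mkA l bk) ≡ mkA l e
rebind-binder ρ l bk e = swA-right l e (ρ l bk)

rebind-other : ∀ {ρ} → Inj ρ → ∀ {l bk e c} → c ≢ mkA l bk → renA ρ c ≢ mkA l e →
               renA (rebind ρ l bk e) c ≡ renA ρ c
rebind-other {ρ} iρ {l} {bk} {e} {c} c≢b ρc≢e =
  swA-other l e (ρ l bk) (renA ρ c) ρc≢e (renA-≢ iρ c≢b)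

rebind-agree : ∀ {ρ σ} → Inj ρ → Inj σ → ∀ {l bk e c} → renA ρ c ≢ mkA l e →
               (c ≢ mkA l bk → renA ρ c ≡ renA σ c) →
               renA (rebind ρ l bk e) c ≡ renA (rebind σ l bk e) c
rebind-agree {ρ} {σ} iρ iσ {l} {bk} {e} {c} ρc≢e agree with c ≟A mkA l bk
... | yes refl = trans (rebind-binder ρ l bk e) (sym (rebind-binder σ l bk e))
... | no c≢b   = begin
  renA (rebind ρ l bk e) c ≡⟨ rebind-other iρ c≢b ρc≢e ⟩
  renA ρ c                 ≡⟨ agree c≢b ⟩
  renA σ c                 ≡⟨ sym (rebind-other iσ c≢b (subst (_≢ mkA l e) (agree c≢b) ρc≢e)) ⟩
  renA (rebind σ l bk e) c ∎
  where open ≡-Reasoning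

rebind-swap : ∀ ρ l bk e X → renP (rebind ρ l bk e) X ≡ swapP l e (ρ l bk) (renP ρ X)
rebind-swap ρ l bk e X =
  sym (trans (swap-renP l e (ρ l bk) (renP ρ X)) (ren-∘P (swName l e (ρ l bk)) ρ X))

mutual
  ≈P-sym : ∀ {X Y} → X ≈P Y → Y ≈P X
  ≈P-sym (and-≈ p q)         = and-≈ (sym-All⁺ q) (sym-All⁻ p)
  ≈P-sym (neg-≈ p)           = neg-≈ (≈P-sym p)
  ≈P-sym (all-≈ c c∉X c∉Y p) = all-≈ c c∉Y c∉X (≈P-sym p)
  ≈P-sym (elt-≈ p)           = elt-≈ (≈S-sym p)

  ≈S-sym : ∀ {i} {x y : Tm i} → x ≈S y → y ≈S x
  ≈S-sym atm-≈               = atm-≈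
  ≈S-sym (st-≈ c c∉X c∉Y p)  = st-≈ c c∉Y c∉X (≈P-sym p)

  sym-All⁺ : ∀ {Xs Ys} → All (λ Y → Any (λ X → X ≈P Y) Xs) Ys → All (λ Y → Any (λ X → Y ≈P X) Xs) Ys
  sym-All⁺ []       = []
  sym-All⁺ (a ∷ as) = sym-Any⁺ a ∷ sym-All⁺ as

  sym-Any⁺ : ∀ {Xs Y} → Any (λ X → X ≈P Y) Xs → Any (λ X → Y ≈P X) Xs
  sym-Any⁺ (here p)  = here (≈P-sym p)
  sym-Any⁺ (there a) = there (sym-Any⁺ a)

  sym-All⁻ : ∀ {Xs Ys} → All (λ X → Any (λ Y → X ≈P Y) Ys) Xs → All (λ X → Any (λ Y → Y ≈P X) Ys) Xs
  sym-All⁻ []       = []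
  sym-All⁻ (a ∷ as) = sym-Any⁻ a ∷ sym-All⁻ as

  sym-Any⁻ : ∀ {Ys X} → Any (λ Y → X ≈P Y) Ys → Any (λ Y → Y ≈P X) Ys
  sym-Any⁻ (here p)  = here (≈P-sym p)
  sym-Any⁻ (there a) = there (sym-Any⁻ a)

-- Binder case: the body comparison happens after swapping the bound
-- atoms n, m with a common fresh c, which leaves the other free atoms alone.
fv-binder : ∀ {j c n m X Y} → mkA j c ∉ fvP X → mkA j c ∉ fvP Y →
            (∀ {d} → d ∈ fvP (swapP j c n X) → d ∈ fvP (swapP j c m Y)) →
            ∀ {d} → d ∈ remove (mkA j n) (fvP X) → d ∈ remove (mkA j m) (fvP Y)
fv-binder {j} {c} {n} {m} {X} {Y} c∉X c∉Y body {d} p with ∈-remove⁻ p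
... | d∈X , d≢n = keep (d ≟A mkA j m)
  where
  d≢c : d ≢ mkA j c
  d≢c refl = c∉X d∈X

  swapped-d∈Y : swA j m c d ∈ fvP Y
  swapped-d∈Y = fv-swap⁻P j c m Y (body (subst (_∈ fvP (swapP j c n X))
                  (swA-other j c n d d≢c d≢n) (fv-swap⁺P j c n X d∈X)))

  keep : Dec (d ≡ mkA j m) → d ∈ remove (mkA j m) (fvP Y)
  keep (yes d≡m) = contradiction
    (subst (_∈ fvP Y) (trans (cong (swA j m c) d≡m) (swA-left j m c)) swapped-d∈Y) c∉Y
  keep (no d≢m)  = ∈-remove⁺ (subst (_∈ fvP Y) (swA-other j m c d d≢m d≢c) swapped-d∈Y) d≢m

mutual
  fv-≈P : ∀ {X Y} → X ≈P Y → ∀ {d} → d ∈ fvP X → d ∈ fvP Y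
  fv-≈P (and-≈ p _)         r = fv-≈All p r
  fv-≈P (neg-≈ p)           r = fv-≈P p r
  fv-≈P (all-≈ {j} {n} {m} {X} {Y} c c∉X c∉Y p) r = fv-binder {j} {c} {n} {m} {X} {Y} c∉X c∉Y (fv-≈P p) r
  fv-≈P (elt-≈ p) (here refl) = here refl
  fv-≈P (elt-≈ p) (there r)   = there (fv-≈S p r)

  fv-≈S : ∀ {i} {x y : Tm i} → x ≈S y → ∀ {d} → d ∈ fvS x → d ∈ fvS y
  fv-≈S atm-≈               r = r
  fv-≈S (st-≈ {i} {n} {m} {X} {Y} c c∉X c∉Y p) r = fv-binder {pred i} {c} {n} {m} {X} {Y} c∉X c∉Y (fv-≈P p) r

  fv-≈All : ∀ {Xs Ys} → All (λ X → Any (λ Y → X ≈P Y) Ys) Xs → ∀ {d} → d ∈ fvPs Xs → d ∈ fvPs Ys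
  fv-≈All {X ∷ Xs} (a ∷ as) r with ∈-++⁻ (fvP X) r
  ... | inj₁ q = fv-≈Any a q
  ... | inj₂ q = fv-≈All as q

  fv-≈Any : ∀ {X Ys} → Any (λ Y → X ≈P Y) Ys → ∀ {d} → d ∈ fvP X → d ∈ fvPs Ys
  fv-≈Any               (here p)  q = ∈-++⁺ˡ (fv-≈P p q)
  fv-≈Any {Ys = Y ∷ Ys} (there a) q = ∈-++⁺ʳ (fvP Y) (fv-≈Any a q)

fv-≈P⁻ : ∀ {X Y} → X ≈P Y → ∀ {d} → d ∈ fvP Y → d ∈ fvP X
fv-≈P⁻ p = fv-≈P (≈P-sym p)

fv-≈S⁻ : ∀ {i} {x y : Tm i} → x ≈S y → ∀ {d} → d ∈ fvS y → d ∈ fvS x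
fv-≈S⁻ p = fv-≈S (≈S-sym p)

Pointwise⇒All-Any : ∀ {A : Set} {R : A → A → Set} {xs ys} → Pointwise R xs ys →
                    All (λ x → Any (R x) ys) xs
Pointwise⇒All-Any []       = []
Pointwise⇒All-Any (r ∷ rs) = here r ∷ All.map there (Pointwise⇒All-Any rs)

Pointwise⇒All-Any′ : ∀ {A : Set} {R : A → A → Set} {xs ys} → Pointwise R xs ys →
                     All (λ y → Any (λ x → R x y) xs) ys
Pointwise⇒All-Any′ []       = []
Pointwise⇒All-Any′ (r ∷ rs) = here r ∷ All.map there (Pointwise⇒All-Any′ rs)

-- Binder case: rename the body with ρ and σ after redirecting the binder
-- to a name e fresh for both renamed bodies.
ren-≈-body : ∀ l bk X {ρ σ} → Inj ρ → Inj σ →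
             (∀ c → c ∈ fvP X → c ≢ mkA l bk → renA ρ c ≡ renA σ c) →
             (∀ {ρ' σ'} → Inj ρ' → Inj σ' → (∀ c → c ∈ fvP X → renA ρ' c ≡ renA σ' c) →
                renP ρ' X ≈P renP σ' X) →
             ∃ λ e → mkA l e ∉ fvP (renP ρ X) × mkA l e ∉ fvP (renP σ X) ×
                     swapP l e (ρ l bk) (renP ρ X) ≈P swapP l e (σ l bk) (renP σ X)
ren-≈-body l bk X {ρ} {σ} iρ iσ agree ren-≈X =
  e , e∉ρX , e∉σX ,
  subst₂ _≈P_ (rebind-swap ρ l bk e X) (rebind-swap σ l bk e X)
    (ren-≈X (rebind-inj iρ l bk e) (rebind-inj iσ l bk e)
       (λ c c∈X → rebind-agree iρ iσ (λ eq → e∉ρX (subst (_∈ fvP (renP ρ X)) eq (fv-ren⁺P iρ X c∈X)))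
                                     (agree c c∈X)))
  where
  e = Product.proj₁ (fresh l (fvP (renP ρ X) ++ fvP (renP σ X)))
  e∉ρX : mkA l e ∉ fvP (renP ρ X)
  e∉ρX p = Product.proj₂ (fresh l (fvP (renP ρ X) ++ fvP (renP σ X))) (∈-++⁺ˡ p)
  e∉σX : mkA l e ∉ fvP (renP σ X)
  e∉σX p = Product.proj₂ (fresh l (fvP (renP ρ X) ++ fvP (renP σ X))) (∈-++⁺ʳ _ p)

mutual
  ren-≈P : ∀ X {ρ σ} → Inj ρ → Inj σ → (∀ c → c ∈ fvP X → renA ρ c ≡ renA σ c) →
           renP ρ X ≈P renP σ X
  ren-≈P (and Xs) iρ iσ agree =
    and-≈ (Pointwise⇒All-Any pw) (Pointwise⇒All-Any′ pw)
    where pw = ren-≈Ps Xs iρ iσ agree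
  ren-≈P (neg X) iρ iσ agree = neg-≈ (ren-≈P X iρ iσ agree)
  ren-≈P (all (mkA l bk) X) iρ iσ agree
    with ren-≈-body l bk X iρ iσ (λ c c∈X c≢b → agree c (∈-remove⁺ c∈X c≢b)) (ren-≈P X)
  ... | e , e∉ρX , e∉σX , body = all-≈ e e∉ρX e∉σX body
  ren-≈P (elt j y k) iρ iσ agree
    rewrite cong nm (agree (mkA j k) (here refl)) =
    elt-≈ (ren-≈S y iρ iσ (λ c c∈y → agree c (there c∈y)))

  ren-≈Ps : ∀ Xs {ρ σ} → Inj ρ → Inj σ → (∀ c → c ∈ fvPs Xs → renA ρ c ≡ renA σ c) →
            Pointwise _≈P_ (renPs ρ Xs) (renPs σ Xs)
  ren-≈Ps []       iρ iσ agree = []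
  ren-≈Ps (X ∷ Xs) iρ iσ agree =
    ren-≈P X iρ iσ (λ c p → agree c (∈-++⁺ˡ p)) ∷
    ren-≈Ps Xs iρ iσ (λ c p → agree c (∈-++⁺ʳ (fvP X) p))

  ren-≈S : ∀ {j} (y : Tm j) {ρ σ} → Inj ρ → Inj σ → (∀ c → c ∈ fvS y → renA ρ c ≡ renA σ c) →
           renS ρ y ≈S renS σ y
  ren-≈S {j} (atm k) iρ iσ agree
    rewrite cong nm (agree (mkA j k) (here refl)) = atm-≈
  ren-≈S {j} (st bk X) iρ iσ agree
    with ren-≈-body (pred j) bk X iρ iσ (λ c c∈X c≢b → agree c (∈-remove⁺ c∈X c≢b)) (ren-≈P X)
  ... | e , e∉ρX , e∉σX , body = st-≈ e e∉ρX e∉σX body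

≈P-refl : ∀ X → X ≈P X
≈P-refl X = subst₂ _≈P_ (ren-idP X) (ren-idP X) (ren-≈P X id-inj id-inj (λ _ _ → refl))

≈S-refl : ∀ {j} (x : Tm j) → x ≈S x
≈S-refl x = subst₂ _≈S_ (ren-idS x) (ren-idS x) (ren-≈S x id-inj id-inj (λ _ _ → refl))

ren-swapA : ∀ {ρ} → Inj ρ → ∀ j p q c → renA ρ (swA j p q c) ≡ swA j (ρ j p) (ρ j q) (renA ρ c)
ren-swapA {ρ} iρ j p q c with c ≟A mkA j p | c ≟A mkA j q
... | yes refl | _        = trans (cong (renA ρ) (swA-left j p q)) (sym (swA-left j (ρ j p) (ρ j q)))
... | no _     | yes refl = trans (cong (renA ρ) (swA-right j p q)) (sym (swA-right j (ρ j p) (ρ j q)))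
... | no c≢p   | no c≢q   =
  trans (cong (renA ρ) (swA-other j p q c c≢p c≢q))
        (sym (swA-other j (ρ j p) (ρ j q) (renA ρ c) (renA-≢ iρ c≢p) (renA-≢ iρ c≢q)))

ren-swapP : ∀ {ρ} → Inj ρ → ∀ j p q X →
            renP ρ (swapP j p q X) ≡ swapP j (ρ j p) (ρ j q) (renP ρ X)
ren-swapP {ρ} iρ j p q X = begin
  renP ρ (swapP j p q X)                  ≡⟨ cong (renP ρ) (swap-renP j p q X) ⟩
  renP ρ (renP (swName j p q) X)          ≡⟨ ren-∘P ρ (swName j p q) X ⟩
  renP (ρ ∘ᵣ swName j p q) X              ≡⟨ ren-congP (λ j' k → cong nm (ren-swapA iρ j p q (mkA j' k))) X ⟩
  renP (swName j (ρ j p) (ρ j q) ∘ᵣ ρ) X  ≡⟨ sym (ren-∘P (swName j (ρ j p) (ρ j q)) ρ X) ⟩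
  renP (swName j (ρ j p) (ρ j q)) (renP ρ X) ≡⟨ sym (swap-renP j (ρ j p) (ρ j q) (renP ρ X)) ⟩
  swapP j (ρ j p) (ρ j q) (renP ρ X)      ∎
  where open ≡-Reasoning

mutual
  ren-resp-≈P : ∀ {ρ} → Inj ρ → ∀ {X Y} → X ≈P Y → renP ρ X ≈P renP ρ Y
  ren-resp-≈P iρ (and-≈ p q) = and-≈ (ren-resp-All iρ p) (ren-resp-All′ iρ q)
  ren-resp-≈P iρ (neg-≈ p)   = neg-≈ (ren-resp-≈P iρ p)
  ren-resp-≈P {ρ} iρ (all-≈ {j} {n} {m} {X} {Y} c c∉X c∉Y p) =
    all-≈ (ρ j c) (fresh-ren iρ X c∉X) (fresh-ren iρ Y c∉Y)
      (subst₂ _≈P_ (ren-swapP iρ j c n X) (ren-swapP iρ j c m Y) (ren-resp-≈P iρ p))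
  ren-resp-≈P iρ (elt-≈ p)   = elt-≈ (ren-resp-≈S iρ p)

  ren-resp-≈S : ∀ {ρ} → Inj ρ → ∀ {i} {x y : Tm i} → x ≈S y → renS ρ x ≈S renS ρ y
  ren-resp-≈S iρ atm-≈ = atm-≈
  ren-resp-≈S {ρ} iρ (st-≈ {i} {n} {m} {X} {Y} c c∉X c∉Y p) =
    st-≈ (ρ (pred i) c) (fresh-ren iρ X c∉X) (fresh-ren iρ Y c∉Y)
      (subst₂ _≈P_ (ren-swapP iρ (pred i) c n X) (ren-swapP iρ (pred i) c m Y) (ren-resp-≈P iρ p))

  ren-resp-All : ∀ {ρ} → Inj ρ → ∀ {Xs Ys} → All (λ X → Any (λ Y → X ≈P Y) Ys) Xs →
                 All (λ X → Any (λ Y → X ≈P Y) (renPs ρ Ys)) (renPs ρ Xs)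
  ren-resp-All iρ []       = []
  ren-resp-All iρ (a ∷ as) = ren-resp-Any iρ a ∷ ren-resp-All iρ as

  ren-resp-Any : ∀ {ρ} → Inj ρ → ∀ {X Ys} → Any (λ Y → X ≈P Y) Ys →
                 Any (λ Y → renP ρ X ≈P Y) (renPs ρ Ys)
  ren-resp-Any iρ (here p)  = here (ren-resp-≈P iρ p)
  ren-resp-Any iρ (there a) = there (ren-resp-Any iρ a)

  ren-resp-All′ : ∀ {ρ} → Inj ρ → ∀ {Xs Ys} → All (λ Y → Any (λ X → X ≈P Y) Xs) Ys →
                  All (λ Y → Any (λ X → X ≈P Y) (renPs ρ Xs)) (renPs ρ Ys)
  ren-resp-All′ iρ []       = []
  ren-resp-All′ iρ (a ∷ as) = ren-resp-Any′ iρ a ∷ ren-resp-All′ iρ as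

  ren-resp-Any′ : ∀ {ρ} → Inj ρ → ∀ {Xs Y} → Any (λ X → X ≈P Y) Xs →
                  Any (λ X → X ≈P renP ρ Y) (renPs ρ Xs)
  ren-resp-Any′ iρ (here p)  = here (ren-resp-≈P iρ p)
  ren-resp-Any′ iρ (there a) = there (ren-resp-Any′ iρ a)

rebind-unchanged : ∀ {ρ} → Inj ρ → ∀ l bk e Y → mkA l e ∉ fvP (renP ρ Y) →
                   ∀ c → c ∈ remove (mkA l bk) (fvP Y) → renA ρ c ≡ renA (rebind ρ l bk e) c
rebind-unchanged {ρ} iρ l bk e Y e∉ρY c p with ∈-remove⁻ p
... | c∈Y , c≢b =
  sym (rebind-other iρ c≢b (λ eq → e∉ρY (subst (_∈ fvP (renP ρ Y)) eq (fv-ren⁺P iρ Y c∈Y))))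

rebind-≈P : ∀ {ρ} → Inj ρ → ∀ l bk e Y → mkA l e ∉ fvP (renP ρ Y) →
            all (renA ρ (mkA l bk)) (renP ρ Y) ≈P all (mkA l e) (renP (rebind ρ l bk e) Y)
rebind-≈P {ρ} iρ l bk e Y e∉ρY =
  subst (λ b → all (renA ρ (mkA l bk)) (renP ρ Y) ≈P all b (renP (rebind ρ l bk e) Y))
        (rebind-binder ρ l bk e)
    (ren-≈P (all (mkA l bk) Y) iρ (rebind-inj iρ l bk e) (rebind-unchanged iρ l bk e Y e∉ρY))

rebind-≈S : ∀ {ρ} → Inj ρ → ∀ k bk e Y → mkA (pred k) e ∉ fvP (renP ρ Y) →
            st {k} (ρ (pred k) bk) (renP ρ Y) ≈S st e (renP (rebind ρ (pred k) bk e) Y)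
rebind-≈S {ρ} iρ k bk e Y e∉ρY =
  subst (λ b → st {k} (ρ (pred k) bk) (renP ρ Y) ≈S st b (renP (rebind ρ (pred k) bk e) Y))
        (cong nm (rebind-binder ρ (pred k) bk e))
    (ren-≈S (st bk Y) iρ (rebind-inj iρ (pred k) bk e) (rebind-unchanged iρ (pred k) bk e Y e∉ρY))

AgreeExcept : Ren → Ren → Atom → List Atom → Set
AgreeExcept f g a L = ∀ c → c ∈ L → c ≢ a → renA f c ≡ renA g c

-- The data produced for a binder b = mkA l bk of a substitution
-- all([b]X)[a ↦ x] = all([b]W) (or the st analogue) once its renamed
-- version is renamed apart: a name e for b fresh for everything around,
-- and the renamed body judgement with b redirected to e.
record RenamedApart (i : ℤ) (n : ℕ) (x : Tm i) (l : ℤ) (bk : ℕ) (X W : Pred) (f g : Ren) : Set where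
  field
    e    : ℕ
    e∉fX : mkA l e ∉ fvP (renP f X)
    e∉gW : mkA l e ∉ fvP (renP g W)
    e∉gx : mkA l e ∉ fvS (renS g x)
    e≢fa : mkA l e ≢ mkA i (f i n)
    body : SubP i (f i n) (renS g x) (renP (rebind f l bk e) X) (renP (rebind g l bk e) W)

rename-apart : ∀ {i n} (x : Tm i) l bk X W {f g} → Inj f → Inj g →
               mkA l bk ≢ mkA i n → mkA l bk ∉ fvS x →
               AgreeExcept f g (mkA i n) (remove (mkA l bk) (fvP X)) →
               (∀ {f' g'} → Inj f' → Inj g' → AgreeExcept f' g' (mkA i n) (fvP X) →
                  SubP i (f' i n) (renS g' x) (renP f' X) (renP g' W)) →
               RenamedApart i n x l bk X W f g
rename-apart {i} {n} x l bk X W {f} {g} if ig b≢a b∉x agree sub-body = record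
  { e = e ; e∉fX = e∉fX ; e∉gW = e∉gW ; e∉gx = e∉gx ; e≢fa = e≢fa
  ; body = s-α x≈ (≈P-refl _) (subst (λ t → SubP i t (renS g' x) (renP f' X) (renP g' W)) f'a≡fa body') (≈P-refl _) }
  where
  LX = fvP (renP f X)
  LW = fvP (renP g W)
  Lx = fvS (renS g x)
  e  = Product.proj₁ (fresh l (LX ++ LW ++ Lx ++ mkA i (f i n) ∷ []))
  e∉ : mkA l e ∉ LX ++ LW ++ Lx ++ mkA i (f i n) ∷ []
  e∉ = Product.proj₂ (fresh l (LX ++ LW ++ Lx ++ mkA i (f i n) ∷ []))
  e∉fX : mkA l e ∉ LX
  e∉fX p = e∉ (∈-++⁺ˡ p)
  e∉gW : mkA l e ∉ LW
  e∉gW p = e∉ (∈-++⁺ʳ LX (∈-++⁺ˡ p))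
  e∉gx : mkA l e ∉ Lx
  e∉gx p = e∉ (∈-++⁺ʳ LX (∈-++⁺ʳ LW (∈-++⁺ˡ p)))
  e≢fa : mkA l e ≢ mkA i (f i n)
  e≢fa eq = e∉ (∈-++⁺ʳ LX (∈-++⁺ʳ LW (∈-++⁺ʳ Lx (here eq))))
  f' = rebind f l bk e
  g' = rebind g l bk e
  body' : SubP i (f' i n) (renS g' x) (renP f' X) (renP g' W)
  body' = sub-body (rebind-inj if l bk e) (rebind-inj ig l bk e) λ c c∈X c≢a →
    rebind-agree if ig (λ eq → e∉fX (subst (_∈ LX) eq (fv-ren⁺P if X c∈X)))
                       (λ c≢b → agree c (∈-remove⁺ c∈X c≢b) c≢a)
  f'a≡fa : f' i n ≡ f i n
  f'a≡fa = cong nm (rebind-other if (λ eq → b≢a (sym eq)) (λ eq → e≢fa (sym eq)))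
  x≈ : renS g x ≈S renS g' x
  x≈ = ren-≈S x ig (rebind-inj ig l bk e) λ c c∈x →
    sym (rebind-other ig (λ { refl → b∉x c∈x })
                         (λ eq → e∉gx (subst (_∈ Lx) eq (fv-ren⁺S ig x c∈x))))

mutual
  sub-renP : ∀ {i n x Z W} → SubP i n x Z W → ∀ {f g} → Inj f → Inj g →
             AgreeExcept f g (mkA i n) (fvP Z) →
             SubP i (f i n) (renS g x) (renP f Z) (renP g W)
  sub-renP (s-and pw) if ig agree = s-and (sub-renPw pw if ig agree)
  sub-renP (s-neg D)  if ig agree = s-neg (sub-renP D if ig agree)
  sub-renP (s-all {x} {mkA l bk} {X} {W} b≢a b∉x D) if ig agree =
    s-α (≈S-refl _) (rebind-≈P if l bk e X e∉fX) (s-all e≢fa e∉gx body)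
        (≈P-sym (rebind-≈P ig l bk e W e∉gW))
    where
    open RenamedApart (rename-apart x l bk X W if ig b≢a b∉x
                         agree (λ if' ig' → sub-renP D if' ig'))
  sub-renP (s-elt-atm D) if ig agree =
    s-elt-atm (sub-renS D if ig λ c c∈y → agree c (there c∈y))
  sub-renP {i} {n} (s-elt-st {y} {y'} {m} {X'} {W} _ Dy DX) {f} {g} if ig agree =
    s-α x≈ (≈P-refl _) (s-elt-st e∉fy Dy' DX') (≈P-refl _)
    where
    -- rename the bound atom of x = st([m]X') apart from the renamed y
    L  = fvS (renS f y) ++ fvP (renP g X')
    e  = Product.proj₁ (fresh (pred i) L)
    e∉fy : mkA (pred i) e ∉ fvS (renS f y)
    e∉fy p = Product.proj₂ (fresh (pred i) L) (∈-++⁺ˡ p)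
    e∉gX : mkA (pred i) e ∉ fvP (renP g X')
    e∉gX p = Product.proj₂ (fresh (pred i) L) (∈-++⁺ʳ (fvS (renS f y)) p)
    h = rebind g (pred i) m e
    x≈ : st {i} (g (pred i) m) (renP g X') ≈S st e (renP h X')
    x≈ = rebind-≈S ig i m e X' e∉gX
    Dy' : SubS i (f i n) (st e (renP h X')) (pred i) (renS f y) (renS g y')
    Dy' = s-α (≈S-sym x≈) (≈S-refl _) (sub-renS Dy if ig λ c c∈y → agree c (there c∈y)) (≈S-refl _)
    DX' : SubP (pred i) e (renS g y') (renP h X') (renP g W)
    DX' = subst (λ t → SubP (pred i) t (renS g y') (renP h X') (renP g W))
            (cong nm (rebind-binder g (pred i) m e))
            (sub-renP DX (rebind-inj ig (pred i) m e) ig λ c c∈X c≢m →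
               sym (rebind-unchanged ig (pred i) m e X' e∉gX c (∈-remove⁺ c∈X c≢m)))
  sub-renP {i} {n} {x} (s-elt-other {j = j} {y} {y'} {m} b≢a D) {f} {g} if ig agree =
    subst (λ t → SubP i (f i n) (renS g x) (elt j (renS f y) (f j m)) (elt j (renS g y') t))
      (cong nm (agree (mkA j m) (here refl) b≢a))
      (s-elt-other (renA-≢ if b≢a) (sub-renS D if ig λ c c∈y → agree c (there c∈y)))
  sub-renP (s-α x≈ Z≈ D W≈) if ig agree =
    s-α (ren-resp-≈S ig x≈) (ren-resp-≈P if Z≈)
        (sub-renP D if ig λ c c∈Z₀ → agree c (fv-≈P⁻ Z≈ c∈Z₀))
        (ren-resp-≈P ig W≈)

  sub-renPw : ∀ {i n x Xs Ws} → Pointwise (SubP i n x) Xs Ws → ∀ {f g} → Inj f → Inj g →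
              AgreeExcept f g (mkA i n) (fvPs Xs) →
              Pointwise (SubP i (f i n) (renS g x)) (renPs f Xs) (renPs g Ws)
  sub-renPw []                      if ig agree = []
  sub-renPw {Xs = X ∷ Xs} (D ∷ Ds) if ig agree =
    sub-renP D if ig (λ c p → agree c (∈-++⁺ˡ p)) ∷
    sub-renPw Ds if ig (λ c p → agree c (∈-++⁺ʳ (fvP X) p))

  sub-renS : ∀ {i n x k z w} → SubS i n x k z w → ∀ {f g} → Inj f → Inj g →
             AgreeExcept f g (mkA i n) (fvS z) →
             SubS i (f i n) (renS g x) k (renS f z) (renS g w)
  sub-renS s-atm-self if ig agree = s-atm-self
  sub-renS {i} {n} {x} (s-atm-other {k = k} {m} b≢a) {f} {g} if ig agree =
    subst (λ t → SubS i (f i n) (renS g x) k (atm (f k m)) (atm t))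
      (cong nm (agree (mkA k m) (here refl) b≢a))
      (s-atm-other (renA-≢ if b≢a))
  sub-renS (s-st {x} {k} {bk} {X} {W} b≢a b∉x D) if ig agree =
    s-α (≈S-refl _) (rebind-≈S if k bk e X e∉fX) (s-st e≢fa e∉gx body)
        (≈S-sym (rebind-≈S ig k bk e W e∉gW))
    where
    open RenamedApart (rename-apart x (pred k) bk X W if ig b≢a b∉x
                         agree (λ if' ig' → sub-renP D if' ig'))
  sub-renS (s-α x≈ z≈ D w≈) if ig agree =
    s-α (ren-resp-≈S ig x≈) (ren-resp-≈S if z≈)
        (sub-renS D if ig λ c c∈z₀ → agree c (fv-≈S⁻ z≈ c∈z₀))
        (ren-resp-≈S ig w≈)

SubP-cong : ∀ {i n n' x x' Z Z' W W'} → n ≡ n' → x ≡ x' → Z ≡ Z' → W ≡ W' →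
            SubP i n x Z W → SubP i n' x' Z' W'
SubP-cong refl refl refl refl D = D

SubS-cong : ∀ {i n n' x x' k z z' w w'} → n ≡ n' → x ≡ x' → z ≡ z' → w ≡ w' →
            SubS i n x k z w → SubS i n' x' k z' w'
SubS-cong refl refl refl refl D = D

swap-swapP : ∀ i n n' Z → swapP i n n' (swapP i n' n Z) ≡ Z
swap-swapP i n n' Z = begin
  swapP i n n' (swapP i n' n Z)                   ≡⟨ cong (swapP i n n') (swap-renP i n' n Z) ⟩
  swapP i n n' (renP (swName i n' n) Z)           ≡⟨ swap-renP i n n' (renP (swName i n' n) Z) ⟩
  renP (swName i n n') (renP (swName i n' n) Z)   ≡⟨ ren-∘P (swName i n n') (swName i n' n) Z ⟩
  renP (swName i n n' ∘ᵣ swName i n' n) Z        ≡⟨ ren-congP (λ j k → cong nm (swA-inv i n n' (mkA j k))) Z ⟩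
  renP idᵣ Z                                      ≡⟨ ren-idP Z ⟩
  Z                                               ∎
  where open ≡-Reasoning

swap-swapS : ∀ i n n' {k} (z : Tm k) → swapS i n n' (swapS i n' n z) ≡ z
swap-swapS i n n' z = begin
  swapS i n n' (swapS i n' n z)                   ≡⟨ cong (swapS i n n') (swap-renS i n' n z) ⟩
  swapS i n n' (renS (swName i n' n) z)           ≡⟨ swap-renS i n n' (renS (swName i n' n) z) ⟩
  renS (swName i n n') (renS (swName i n' n) z)   ≡⟨ ren-∘S (swName i n n') (swName i n' n) z ⟩
  renS (swName i n n' ∘ᵣ swName i n' n) z        ≡⟨ ren-congS (λ j k → cong nm (swA-inv i n n' (mkA j k))) z ⟩
  renS idᵣ z                                      ≡⟨ ren-idS z ⟩
  z                                               ∎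
  where open ≡-Reasoning

fresh-swapP : ∀ {i n n' Z} → mkA i n' ∉ fvP Z → mkA i n ∉ fvP (swapP i n' n Z)
fresh-swapP {i} {n} {n'} {Z} a'∉Z p = a'∉Z (subst (_∈ fvP Z) (swA-left i n n') (fv-swap⁻P i n' n Z p))

fresh-swapS : ∀ {i n n' k} {z : Tm k} → mkA i n' ∉ fvS z → mkA i n ∉ fvS (swapS i n' n z)
fresh-swapS {i} {n} {n'} {z = z} a'∉z p = a'∉z (subst (_∈ fvS z) (swA-left i n n') (fv-swap⁻S i n' n z p))

-- For a' fresh in Z:  Z[a ↦ x] = W  ⇒  ((a' a)·Z)[a' ↦ x] = W.  This is
-- equivariance under (a' a) applied to Z only: it fixes the other free
-- atoms of Z, and x and W are left alone.
sub-swapP : ∀ {i n n' x Z W} → mkA i n' ∉ fvP Z → SubP i n x Z W → SubP i n' x (swapP i n' n Z) W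
sub-swapP {i} {n} {n'} {x} {Z} {W} a'∉Z D =
  SubP-cong (cong nm (swA-right i n' n)) (ren-idS x) (sym (swap-renP i n' n Z)) (ren-idP W)
    (sub-renP D (swap-inj i n' n) id-inj λ c c∈Z c≢a →
       swA-other i n' n c (λ { refl → a'∉Z c∈Z }) c≢a)

sub-swapS : ∀ {i n n' x k z w} → mkA i n' ∉ fvS z → SubS i n x k z w → SubS i n' x k (swapS i n' n z) w
sub-swapS {i} {n} {n'} {x} {z = z} {w} a'∉z D =
  SubS-cong (cong nm (swA-right i n' n)) (ren-idS x) (sym (swap-renS i n' n z)) (ren-idS w)
    (sub-renS D (swap-inj i n' n) id-inj λ c c∈z c≢a →
       swA-other i n' n c (λ { refl → a'∉z c∈z }) c≢a)

-- The converse is the same statement applied to (a' a)·Z, for which a is fresh.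
sub-swap⇔P : ∀ {i n n' x Z W} → mkA i n' ∉ fvP Z →
             SubP i n x Z W ⇔ SubP i n' x (swapP i n' n Z) W
sub-swap⇔P {i} {n} {n'} {Z = Z} a'∉Z = mk⇔ (sub-swapP a'∉Z) λ D →
  SubP-cong refl refl (swap-swapP i n n' Z) refl (sub-swapP (fresh-swapP {Z = Z} a'∉Z) D)

sub-swap⇔S : ∀ {i n n' x k z w} → mkA i n' ∉ fvS z →
             SubS i n x k z w ⇔ SubS i n' x k (swapS i n' n z) w
sub-swap⇔S {i} {n} {n'} {z = z} a'∉z = mk⇔ (sub-swapS a'∉z) λ D →
  SubS-cong refl refl (swap-swapS i n n' z) refl (sub-swapS (fresh-swapS {z = z} a'∉z) D)

mutual
  sub-fvP : ∀ {i n x Z W} → SubP i n x Z W → ∀ c → c ∈ fvP W →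
            (c ∈ fvP Z × c ≢ mkA i n) ⊎ c ∈ fvS x
  sub-fvP (s-and pw)    c p = sub-fvPw pw c p
  sub-fvP (s-neg D)     c p = sub-fvP D c p
  sub-fvP (s-all _ _ D) c p with ∈-remove⁻ p
  ... | c∈W , c≢b = Sum.map₁ (Product.map₁ λ c∈X → ∈-remove⁺ c∈X c≢b) (sub-fvP D c c∈W)
  sub-fvP (s-elt-atm D) c (here refl) = inj₂ (here refl)
  sub-fvP (s-elt-atm D) c (there p)   = Sum.map₁ (Product.map₁ there) (sub-fvS D c p)
  sub-fvP (s-elt-st _ Dy DX) c p =
    [ (λ { (c∈X , c≢m) → inj₂ (∈-remove⁺ c∈X c≢m) })
    , (λ c∈y' → Sum.map₁ (Product.map₁ there) (sub-fvS Dy c c∈y'))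
    ]′ (sub-fvP DX c p)
  sub-fvP (s-elt-other b≢a D) c (here refl) = inj₁ (here refl , b≢a)
  sub-fvP (s-elt-other b≢a D) c (there p)   = Sum.map₁ (Product.map₁ there) (sub-fvS D c p)
  sub-fvP (s-α x≈ Z≈ D W≈) c p =
    Sum.map (Product.map₁ (fv-≈P⁻ Z≈)) (fv-≈S⁻ x≈) (sub-fvP D c (fv-≈P⁻ W≈ p))

  sub-fvPw : ∀ {i n x Xs Ws} → Pointwise (SubP i n x) Xs Ws → ∀ c → c ∈ fvPs Ws →
             (c ∈ fvPs Xs × c ≢ mkA i n) ⊎ c ∈ fvS x
  sub-fvPw {Xs = X ∷ Xs} {W ∷ Ws} (D ∷ Ds) c p with ∈-++⁻ (fvP W) p
  ... | inj₁ q = Sum.map₁ (Product.map₁ ∈-++⁺ˡ) (sub-fvP D c q)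
  ... | inj₂ q = Sum.map₁ (Product.map₁ (∈-++⁺ʳ (fvP X))) (sub-fvPw Ds c q)

  sub-fvS : ∀ {i n x k z w} → SubS i n x k z w → ∀ c → c ∈ fvS w →
            (c ∈ fvS z × c ≢ mkA i n) ⊎ c ∈ fvS x
  sub-fvS s-atm-self        c p           = inj₂ p
  sub-fvS (s-atm-other b≢a) c (here refl) = inj₁ (here refl , b≢a)
  sub-fvS (s-st _ _ D)      c p with ∈-remove⁻ p
  ... | c∈W , c≢b = Sum.map₁ (Product.map₁ λ c∈X → ∈-remove⁺ c∈X c≢b) (sub-fvP D c c∈W)
  sub-fvS (s-α x≈ z≈ D w≈)  c p =
    Sum.map (Product.map₁ (fv-≈S⁻ z≈)) (fv-≈S⁻ x≈) (sub-fvS D c (fv-≈S⁻ w≈ p))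

sub-freshP : ∀ {i n x Z W} → mkA i n ∉ fvS x → SubP i n x Z W → mkA i n ∉ fvP W
sub-freshP a∉x D a∈W = [ (λ { (_ , a≢a) → a≢a refl }) , a∉x ]′ (sub-fvP D _ a∈W)

sub-freshS : ∀ {i n x k z w} → mkA i n ∉ fvS x → SubS i n x k z w → mkA i n ∉ fvS w
sub-freshS a∉x D a∈w = [ (λ { (_ , a≢a) → a≢a refl }) , a∉x ]′ (sub-fvS D _ a∈w)

lemma4p8 : (i : ℤ) (n n' : ℕ) → n ≢ n' → (x : Tm i) →
           (Z : Pred) → mkA i n' ∉ fvP Z →
           (k : ℤ) (z : Tm k) → mkA i n' ∉ fvS z →
           ((∀ W → SubP i n x Z W ⇔ SubP i n' x (swapP i n' n Z) W)
             × (∀ w → SubS i n x k z w ⇔ SubS i n' x k (swapS i n' n z) w))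
           × ((∀ W → SubP i n x Z W → ∀ c → c ∈ fvP W →
                 (c ∈ fvP Z × c ≢ mkA i n) ⊎ c ∈ fvS x)
             × (∀ w → SubS i n x k z w → ∀ c → c ∈ fvS w →
                 (c ∈ fvS z × c ≢ mkA i n) ⊎ c ∈ fvS x))
           × (mkA i n ∉ fvS x →
               (∀ W → SubP i n x Z W → mkA i n ∉ fvP W)
               × (∀ w → SubS i n x k z w → mkA i n ∉ fvS w))
lemma4p8 i n n' _ x Z a'∉Z k z a'∉z =
  ((λ W → sub-swap⇔P a'∉Z) , (λ w → sub-swap⇔S a'∉z)) ,
  ((λ W → sub-fvP) , (λ w → sub-fvS)) ,
  (λ a∉x → (λ W → sub-freshP a∉x) , (λ w → sub-freshS a∉x))
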